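{- Let $n\ge1$, let $H_1,H_2$ be two edge-disjoint Hamilton cycles of $G_{n,3}$, and let $E_1,E_2$ be two edge-disjoint directed Hamilton cycles of $Q_{2n}$. Then the four Hamilton cycles $g(E_1,H_1)$, $g(E_1,H_2)$, $g(E_2,H_1)$, $g(E_2,H_2)$ of $Q_{6n}$ are pairwise edge-disjoint.
   Context: $G_{n,3}=C_{4^n}\Box C_{4^n}\Box C_{4^n}$: vertices $(x,y,z)$ with coordinates in $\mathbb{Z}/4^n\mathbb{Z}$, adjacent iff they differ in one coordinate by $\pm1$. $Q_{2m}$ is identified with $C_4\Box\cdots\Box C_4$ ($m$ factors): quaternary strings of length $m$, adjacent iff differing in one position by $\pm1\pmod4$. Directed Hamilton cycles start and end at the origin. Definition of $g$: for a directed Hamilton cycle $E$ of $Q_{2n}$, let $\varphi_E(u)=t$ if $u$ is the $t$-th vertex of $E$ (origin is the $0$-th), a bijection $V(Q_{2n})\to\mathbb{Z}/4^n\mathbb{Z}$. Identify $Q_{6n}=Q_{2n}\Box Q_{2n}\Box Q_{2n}$, a vertex $(u,v,w)$ having $u$ on axes $1,\dots,n$, $v$ on axes $n+1,\dots,2n$, $w$ on axes $2n+1,\dots,3n$. The map $(u,v,w)\mapsto(\varphi_E(u),\varphi_E(v),\varphi_E(w))$ is a bijection onto $V(G_{n,3})$ fixing the origin, under which every edge of $G_{n,3}$ pulls back to an edge of $Q_{6n}$; for a directed Hamilton cycle $H$ of $G_{n,3}$, $g(E,H)$ is the Hamilton cycle of $Q_{6n}$ that is the preimage of $H$. -}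

module Defs where

open import Data.Nat using (ℕ; zero; suc; _+_; _*_; _^_; _≤_)
import Data.Fin
open import Data.Fin using (Fin; toℕ)
open import Data.Vec using (Vec; lookup; replicate; _++_)
open import Data.Product using (Σ; ∃; _×_; _,_)
open import Data.Sum using (_⊎_)
open import Data.Empty using (⊥)
open import Relation.Nullary using (¬_)
open import Relation.Binary.PropositionalEquality using (_≡_)
open import Function.Bundles using (_↔_; Inverse)

-- Cyclic successor in ℤ/Mℤ, with ℤ/Mℤ represented by Fin M:
-- b = a + 1 (mod M).
SuccMod : (M : ℕ) → Fin M → Fin M → Set
SuccMod M a b = (suc (toℕ a) ≡ toℕ b) ⊎ (suc (toℕ a) ≡ M × toℕ b ≡ 0)

AdjMod : (M : ℕ) → Fin M → Fin M → Set
AdjMod M a b = SuccMod M a b ⊎ SuccMod M b a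

-- Q_{2m} = C_4 □ ⋯ □ C_4 (m factors): quaternary strings of length m,
-- adjacent iff they differ in exactly one position, by ±1 (mod 4).

QVert : ℕ → Set
QVert m = Vec (Fin 4) m

QOrigin : (m : ℕ) → QVert m
QOrigin m = replicate m Data.Fin.zero

QAdj : (m : ℕ) → QVert m → QVert m → Set
QAdj m u v = Σ (Fin m) λ i →
  AdjMod 4 (lookup u i) (lookup v i) × (∀ j → ¬ (j ≡ i) → lookup u j ≡ lookup v j)

-- G_{n,3} = C_{4^n} □ C_{4^n} □ C_{4^n}.

GVert : ℕ → Set
GVert n = Fin (4 ^ n) × Fin (4 ^ n) × Fin (4 ^ n)

IsGOrigin : (n : ℕ) → GVert n → Set
IsGOrigin n (x , y , z) = toℕ x ≡ 0 × toℕ y ≡ 0 × toℕ z ≡ 0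

GAdj : (n : ℕ) → GVert n → GVert n → Set
GAdj n (x , y , z) (x' , y' , z') =
    (AdjMod (4 ^ n) x x' × y ≡ y' × z ≡ z')
  ⊎ (x ≡ x' × AdjMod (4 ^ n) y y' × z ≡ z')
  ⊎ (x ≡ x' × y ≡ y' × AdjMod (4 ^ n) z z')

-- Directed Hamilton cycles starting (and ending) at the origin, given as
-- a bijection  Fin N ↔ V  (t ↦ t-th vertex of the cycle), where N = |V|,
-- the 0-th vertex being the origin and the t-th and (t+1 mod N)-th
-- vertices being adjacent.

record DirHamCycle (V : Set) (IsOrigin : V → Set) (Adj : V → V → Set) (N : ℕ) : Set₁ where
  field
    seq      : Fin N ↔ V
  vertex : Fin N → V
  vertex = Inverse.to seq
  field
    start    : ∀ t → toℕ t ≡ 0 → IsOrigin (vertex t)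
    adjacent : ∀ s t → SuccMod N s t → Adj (vertex s) (vertex t)

open DirHamCycle public

QCycle : ℕ → Set₁
QCycle m = DirHamCycle (QVert m) (λ u → u ≡ QOrigin m) (QAdj m) (4 ^ m)

GCycle : ℕ → Set₁
GCycle n = DirHamCycle (GVert n) (IsGOrigin n) (GAdj n) (4 ^ n * 4 ^ n * 4 ^ n)

SeqEdge : {V : Set} (N : ℕ) → (Fin N → V) → V → V → Set
SeqEdge N s a b = Σ (Fin N) λ i → Σ (Fin N) λ j →
  SuccMod N i j × ((s i ≡ a × s j ≡ b) ⊎ (s i ≡ b × s j ≡ a))

EdgeDisjoint : {V : Set} (N : ℕ) → (Fin N → V) → (Fin N → V) → Set
EdgeDisjoint N s t = ∀ a b → SeqEdge N s a b → SeqEdge N t a b → ⊥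

φ : {m : ℕ} → QCycle m → QVert m → Fin (4 ^ m)
φ E = Inverse.from (seq E)

-- g(E,H): the preimage of H under (u,v,w) ↦ (φ_E u, φ_E v, φ_E w), where
-- Q_{6n} = Q_{2n} □ Q_{2n} □ Q_{2n} with u on axes 1..n, v on axes
-- n+1..2n, w on axes 2n+1..3n.
gSeq : {n : ℕ} → QCycle n → GCycle n → Fin (4 ^ n * 4 ^ n * 4 ^ n) → QVert (n + n + n)
gSeq E H t with vertex H t
... | (x , y , z) = (vertex E x ++ vertex E y) ++ vertex E z

module Submission where

-- gSeq E H is the image of the cycle H under the injective "cube" map
-- (x , y , z) ↦ E x ++ E y ++ E z, so two images under the same E inherit
-- edge-disjointness from H₁, H₂.  Under different E₁, E₂, an edge of a
-- G_{n,3}-cycle moves one coordinate along an E-edge and fixes the other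
-- two.  If an E₁-image edge and an E₂-image edge coincided, either they
-- move the same block, and then E₁ and E₂ would share an edge, or they
-- move different blocks, and then E₁ would map two distinct adjacent
-- vertices to the same vertex.

open import Defs
open import Data.Nat using (ℕ; zero; suc; _≤_; _+_; _*_; _^_)
open import Data.Nat.Properties using (1+n≢n; m^n≡1⇒n≡0∨m≡1)
open import Data.Product using (_×_; _,_)
open import Data.Sum using (inj₁; inj₂)
open import Data.Empty using (⊥)
open import Data.Fin using (Fin)
open import Data.Vec using (Vec; _++_)
open import Data.Vec.Properties using (++-injective)
open import Function.Base using (_∘_)
open import Function.Bundles using (Injection)
open import Function.Definitions using (Injective)
open import Function.Properties.Inverse using (↔⇒↣)
open import Relation.Nullary using (¬_)
open import Relation.Binary.Definitions using (Symmetric)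
open import Relation.Binary.PropositionalEquality
  using (_≡_; _≢_; refl; sym; trans; cong; cong₂; subst; subst₂)

private
  variable
    V W : Set
    N : ℕ

AdjMod⇒SeqEdge : (s : Fin N → V) {i j : Fin N} → AdjMod N i j →
  SeqEdge N s (s i) (s j)
AdjMod⇒SeqEdge s {i} {j} (inj₁ i→j) = i , j , i→j , inj₁ (refl , refl)
AdjMod⇒SeqEdge s {i} {j} (inj₂ j→i) = j , i , j→i , inj₂ (refl , refl)

SeqEdge-map⁻ : {f : V → W} → Injective _≡_ _≡_ f →
  {s : Fin N → V} {a b : V} → SeqEdge N (f ∘ s) (f a) (f b) → SeqEdge N s a b
SeqEdge-map⁻ f-inj (i , j , i→j , inj₁ (p , q)) = i , j , i→j , inj₁ (f-inj p , f-inj q)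
SeqEdge-map⁻ f-inj (i , j , i→j , inj₂ (p , q)) = i , j , i→j , inj₂ (f-inj p , f-inj q)

EdgeDisjoint-map : {f : V → W} → Injective _≡_ _≡_ f → {s t : Fin N → V} →
  EdgeDisjoint N s t → EdgeDisjoint N (f ∘ s) (f ∘ t)
EdgeDisjoint-map f-inj {s} disj _ _ (i , j , i→j , inj₁ (refl , refl)) e =
  disj (s i) (s j) (i , j , i→j , inj₁ (refl , refl)) (SeqEdge-map⁻ f-inj e)
EdgeDisjoint-map f-inj {s} disj _ _ (i , j , i→j , inj₂ (refl , refl)) e =
  disj (s j) (s i) (i , j , i→j , inj₂ (refl , refl)) (SeqEdge-map⁻ f-inj e)

DisjointEdgeImages : {A : Set} → (A → A → Set) → (A → V) → (A → V) → Set
DisjointEdgeImages Adj f f' = ∀ {a a' c c'} → Adj a a' → Adj c c' →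
  f a ≡ f' c → f a' ≡ f' c' → ⊥

EdgeDisjoint⇒DisjointEdgeImages : {s t : Fin N → V} →
  EdgeDisjoint N s t → DisjointEdgeImages (AdjMod N) s t
EdgeDisjoint⇒DisjointEdgeImages {s = s} {t} disj a~a' c~c' p q =
  disj _ _ (AdjMod⇒SeqEdge s a~a')
    (subst₂ (SeqEdge _ t) (sym p) (sym q) (AdjMod⇒SeqEdge t c~c'))

DisjointEdgeImages⇒EdgeDisjoint : {A : Set} {Adj : A → A → Set} → Symmetric Adj →
  {f f' : A → V} → DisjointEdgeImages Adj f f' →
  {s t : Fin N → A} →
  (∀ i j → SuccMod N i j → Adj (s i) (s j)) →
  (∀ i j → SuccMod N i j → Adj (t i) (t j)) →
  EdgeDisjoint N (f ∘ s) (f' ∘ t)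
DisjointEdgeImages⇒EdgeDisjoint sym-Adj disj s-walk t-walk _ _
  (i , j , i→j , e) (i' , j' , i'→j' , e') with e | e'
... | inj₁ (p , q) | inj₁ (p' , q') =
  disj (s-walk i j i→j) (t-walk i' j' i'→j') (trans p (sym p')) (trans q (sym q'))
... | inj₁ (p , q) | inj₂ (q' , p') =
  disj (s-walk i j i→j) (sym-Adj (t-walk i' j' i'→j')) (trans p (sym p')) (trans q (sym q'))
... | inj₂ (q , p) | inj₁ (p' , q') =
  disj (sym-Adj (s-walk i j i→j)) (t-walk i' j' i'→j') (trans p (sym p')) (trans q (sym q'))
... | inj₂ (q , p) | inj₂ (q' , p') =
  disj (s-walk i j i→j) (t-walk i' j' i'→j') (trans q (sym q')) (trans p (sym p'))

AdjMod-sym : {M : ℕ} → Symmetric (AdjMod M)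
AdjMod-sym (inj₁ a→b) = inj₂ a→b
AdjMod-sym (inj₂ b→a) = inj₁ b→a

SuccMod-irrefl : {M : ℕ} → M ≢ 1 → {a : Fin M} → ¬ SuccMod M a a
SuccMod-irrefl _ (inj₁ 1+a≡a) = 1+n≢n 1+a≡a
SuccMod-irrefl M≢1 (inj₂ (1+a≡M , a≡0)) = M≢1 (trans (sym 1+a≡M) (cong suc a≡0))

AdjMod-irrefl : {M : ℕ} → M ≢ 1 → {a : Fin M} → ¬ AdjMod M a a
AdjMod-irrefl M≢1 (inj₁ a→a) = SuccMod-irrefl M≢1 a→a
AdjMod-irrefl M≢1 (inj₂ a→a) = SuccMod-irrefl M≢1 a→a

4^n≢1 : {n : ℕ} → 1 ≤ n → 4 ^ n ≢ 1
4^n≢1 {zero} ()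
4^n≢1 {suc k} _ 4^n≡1 with m^n≡1⇒n≡0∨m≡1 4 (suc k) 4^n≡1
... | inj₁ ()
... | inj₂ ()

GAdj-sym : {n : ℕ} → Symmetric (GAdj n)
GAdj-sym (inj₁ (x~x' , y≡y' , z≡z')) = inj₁ (AdjMod-sym x~x' , sym y≡y' , sym z≡z')
GAdj-sym (inj₂ (inj₁ (x≡x' , y~y' , z≡z'))) = inj₂ (inj₁ (sym x≡x' , AdjMod-sym y~y' , sym z≡z'))
GAdj-sym (inj₂ (inj₂ (x≡x' , y≡y' , z~z'))) = inj₂ (inj₂ (sym x≡x' , sym y≡y' , AdjMod-sym z~z'))

module _ {A : Set} {m : ℕ} where

  cube : {M : ℕ} → (Fin M → Vec A m) → Fin M × Fin M × Fin M → Vec A (m + m + m)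
  cube f (x , y , z) = (f x ++ f y) ++ f z

  cube-≡ : {M : ℕ} (f f' : Fin M → Vec A m) {x y z x' y' z' : Fin M} →
    cube f (x , y , z) ≡ cube f' (x' , y' , z') →
    f x ≡ f' x' × f y ≡ f' y' × f z ≡ f' z'
  cube-≡ f f' {x} {y} {z} {x'} {y'} eq
    with ++-injective (f x ++ f y) (f' x' ++ f' y') eq
  ... | xy≡x'y' , z≡z' with ++-injective (f x) (f' x') xy≡x'y'
  ... | x≡x' , y≡y' = x≡x' , y≡y' , z≡z'

  cube-injective : {M : ℕ} {f : Fin M → Vec A m} → Injective _≡_ _≡_ f →
    Injective _≡_ _≡_ (cube f)
  cube-injective {f = f} f-inj {_ , _ , _} {_ , _ , _} eq with cube-≡ f f eq
  ... | x≡x' , y≡y' , z≡z' =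
    cong₂ _,_ (f-inj x≡x') (cong₂ _,_ (f-inj y≡y') (f-inj z≡z'))

  cube-disjointEdgeImages : {n : ℕ} → 1 ≤ n → {f f' : Fin (4 ^ n) → Vec A m} →
    Injective _≡_ _≡_ f → DisjointEdgeImages (AdjMod (4 ^ n)) f f' →
    DisjointEdgeImages (GAdj n) (cube f) (cube f')
  cube-disjointEdgeImages {n} 1≤n {f} {f'} f-inj disj p~q p'~q' p≡p' q≡q' =
    go p~q p'~q' (cube-≡ f f' p≡p') (cube-≡ f f' q≡q')
    where
    -- The block moved by f is fixed by f', so injectivity of f
    -- collapses the f-edge to a loop.
    collapse : ∀ {a a' c} → AdjMod (4 ^ n) a a' → f a ≡ c → f a' ≡ c → ⊥
    collapse a~a' fa≡c fa'≡c =
      AdjMod-irrefl (4^n≢1 1≤n) (subst (AdjMod _ _) (f-inj (trans fa'≡c (sym fa≡c))) a~a')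

    go : ∀ {x y z x' y' z' u v w u' v' w'} →
      GAdj n (x , y , z) (x' , y' , z') → GAdj n (u , v , w) (u' , v' , w') →
      f x ≡ f' u × f y ≡ f' v × f z ≡ f' w →
      f x' ≡ f' u' × f y' ≡ f' v' × f z' ≡ f' w' → ⊥
    go (inj₁ (a , refl , refl)) (inj₁ (c , refl , refl)) (e , _) (e' , _) = disj a c e e'
    go (inj₁ (a , refl , refl)) (inj₂ (inj₁ (refl , _ , refl))) (e , _) (e' , _) = collapse a e e'
    go (inj₁ (a , refl , refl)) (inj₂ (inj₂ (refl , refl , _))) (e , _) (e' , _) = collapse a e e'
    go (inj₂ (inj₁ (refl , a , refl))) (inj₁ (_ , refl , refl)) (_ , e , _) (_ , e' , _) = collapse a e e'
    go (inj₂ (inj₁ (refl , a , refl))) (inj₂ (inj₁ (refl , c , refl))) (_ , e , _) (_ , e' , _) = disj a c e e'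
    go (inj₂ (inj₁ (refl , a , refl))) (inj₂ (inj₂ (refl , refl , _))) (_ , e , _) (_ , e' , _) = collapse a e e'
    go (inj₂ (inj₂ (refl , refl , a))) (inj₁ (_ , refl , refl)) (_ , _ , e) (_ , _ , e') = collapse a e e'
    go (inj₂ (inj₂ (refl , refl , a))) (inj₂ (inj₁ (refl , _ , refl))) (_ , _ , e) (_ , _ , e') = collapse a e e'
    go (inj₂ (inj₂ (refl , refl , a))) (inj₂ (inj₂ (refl , refl , c))) (_ , _ , e) (_ , _ , e') = disj a c e e'

vertex-injective : {V : Set} {O : V → Set} {Adj : V → V → Set}
  (C : DirHamCycle V O Adj N) → Injective _≡_ _≡_ (vertex C)
vertex-injective C = Injection.injective (↔⇒↣ (seq C))

gSeq-sameCycle : {n : ℕ} (E : QCycle n) (H₁ H₂ : GCycle n) →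
  EdgeDisjoint (4 ^ n * 4 ^ n * 4 ^ n) (vertex H₁) (vertex H₂) →
  EdgeDisjoint (4 ^ n * 4 ^ n * 4 ^ n) (gSeq E H₁) (gSeq E H₂)
gSeq-sameCycle E H₁ H₂ =
  EdgeDisjoint-map (cube-injective (vertex-injective E)) {vertex H₁} {vertex H₂}

gSeq-crossCycles : {n : ℕ} → 1 ≤ n → (E₁ E₂ : QCycle n) →
  EdgeDisjoint (4 ^ n) (vertex E₁) (vertex E₂) → (H H' : GCycle n) →
  EdgeDisjoint (4 ^ n * 4 ^ n * 4 ^ n) (gSeq E₁ H) (gSeq E₂ H')
gSeq-crossCycles {n} 1≤n E₁ E₂ dE H H' =
  DisjointEdgeImages⇒EdgeDisjoint (GAdj-sym {n}) {f = cube (vertex E₁)} {cube (vertex E₂)}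
    (cube-disjointEdgeImages {n = n} 1≤n (vertex-injective E₁) (EdgeDisjoint⇒DisjointEdgeImages dE))
    {vertex H} {vertex H'} (adjacent H) (adjacent H')

lemma5 : (n : ℕ) → 1 ≤ n →
    (H₁ H₂ : GCycle n) → EdgeDisjoint (4 ^ n * 4 ^ n * 4 ^ n) (vertex H₁) (vertex H₂) →
    (E₁ E₂ : QCycle n) → EdgeDisjoint (4 ^ n) (vertex E₁) (vertex E₂) →
    let N = 4 ^ n * 4 ^ n * 4 ^ n in
      EdgeDisjoint N (gSeq E₁ H₁) (gSeq E₁ H₂)
    × EdgeDisjoint N (gSeq E₁ H₁) (gSeq E₂ H₁)
    × EdgeDisjoint N (gSeq E₁ H₁) (gSeq E₂ H₂)
    × EdgeDisjoint N (gSeq E₁ H₂) (gSeq E₂ H₁)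
    × EdgeDisjoint N (gSeq E₁ H₂) (gSeq E₂ H₂)
    × EdgeDisjoint N (gSeq E₂ H₁) (gSeq E₂ H₂)
lemma5 n 1≤n H₁ H₂ dH E₁ E₂ dE =
    gSeq-sameCycle E₁ H₁ H₂ dH
  , cross H₁ H₁ , cross H₁ H₂ , cross H₂ H₁ , cross H₂ H₂
  , gSeq-sameCycle E₂ H₁ H₂ dH
  where
  cross : (H H' : GCycle n) →
    EdgeDisjoint (4 ^ n * 4 ^ n * 4 ^ n) (gSeq E₁ H) (gSeq E₂ H')
  cross = gSeq-crossCycles 1≤n E₁ E₂ dE
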